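{- Let $X$ be a finite non-empty set with $n=|X|$, and let $\mathcal S$ and $\mathcal T$ be balanced rooted binary phylogenetic $X$-trees. Then $\mathrm{mast}(\mathcal S,\mathcal T)\ge n^{0.17}$; in particular, if $n\ge 2$, then $\mathrm{mast}(\mathcal S,\mathcal T)\ge n^{0.17}>n^{1/6}$.
   Context: A rooted phylogenetic $X$-tree is a rooted tree whose leaf set is the finite non-empty set $X$ (leaves labelled bijectively by $X$) with no degree-two vertices except possibly the root, which has degree at least two; if $|X|=1$ the tree may be a single vertex. It is binary if $|X|=1$ or the root has degree two and every other interior vertex has degree three. The height of a tree is the number of edges on a longest root-to-leaf path. A rooted binary phylogenetic tree is balanced if it has $2^m$ leaves for some integer $m\ge0$ and height $m$. For $Y\subseteq X$, the restriction $\mathcal T|Y$ is obtained from the minimal subtree of $\mathcal T$ connecting the leaves in $Y$ by suppressing non-root degree-two vertices. $\mathrm{mast}(\mathcal S,\mathcal T)$ is the maximum $|Y|$ over subsets $Y$ of the common leaf set such that $\mathcal S|Y$ and $\mathcal T|Y$ are isomorphic as leaf-labelled rooted trees. -}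

module Defs where

open import Data.Nat using (ℕ; suc; _+_; _⊔_; _^_)
open import Data.Bool using (Bool; true; false; if_then_else_)
open import Data.Maybe using (Maybe; just; nothing)
open import Data.List using (List; []; _∷_; _++_; length; allFin)
open import Data.List.Relation.Binary.Permutation.Propositional using (_↭_)
open import Data.Fin using (Fin)
open import Data.Fin.Subset using (Subset; ∣_∣)
open import Data.Vec using (lookup)
open import Data.Product using (Σ; ∃; _×_; _,_)
open import Data.Sum using (_⊎_)
open import Relation.Binary.PropositionalEquality using (_≡_)
open import Data.Nat using (_≤_)

-- A leaf alone is the single-vertex tree; every interior vertex has
-- exactly two children (root of degree two, other interior vertices degree three).
data BTree (A : Set) : Set where
  leaf : A → BTree A
  node : BTree A → BTree A → BTree A

leaves : {A : Set} → BTree A → List A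
leaves (leaf a)   = a ∷ []
leaves (node l r) = leaves l ++ leaves r

height : {A : Set} → BTree A → ℕ
height (leaf _)   = 0
height (node l r) = suc (height l ⊔ height r)

-- A rooted binary phylogenetic X-tree with X = Fin n:
-- leaves labelled bijectively by Fin n.
IsPhyloTree : (n : ℕ) → BTree (Fin n) → Set
IsPhyloTree n T = leaves T ↭ allFin n

IsBalanced : {A : Set} → BTree A → Set
IsBalanced T = ∃ λ m → (length (leaves T) ≡ 2 ^ m) × (height T ≡ m)

-- Restriction T|Y: minimal subtree connecting the leaves in Y, with
-- non-root degree-two vertices suppressed (nothing if Y ∩ leaves = ∅).
restrict : {n : ℕ} → Subset n → BTree (Fin n) → Maybe (BTree (Fin n))
restrict Y (leaf a) = if lookup Y a then just (leaf a) else nothing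
restrict Y (node l r) with restrict Y l | restrict Y r
... | just l' | just r'  = just (node l' r')
... | just l' | nothing  = just l'
... | nothing | just r'  = just r'
... | nothing | nothing  = nothing

data _≅_ {A : Set} : BTree A → BTree A → Set where
  leaf≅ : ∀ a → leaf a ≅ leaf a
  node≅ : ∀ {l r l' r'} → l ≅ l' → r ≅ r' → node l r ≅ node l' r'
  swap≅ : ∀ {l r l' r'} → l ≅ r' → r ≅ l' → node l r ≅ node l' r'

data _≅ᴹ_ {A : Set} : Maybe (BTree A) → Maybe (BTree A) → Set where
  nothing≅ : nothing ≅ᴹ nothing
  just≅    : ∀ {S T} → S ≅ T → just S ≅ᴹ just T

Agree : {n : ℕ} → BTree (Fin n) → BTree (Fin n) → Subset n → Set
Agree S T Y = restrict Y S ≅ᴹ restrict Y T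

IsMast : {n : ℕ} → BTree (Fin n) → BTree (Fin n) → ℕ → Set
IsMast {n} S T k =
  (Σ (Subset n) λ Y → Agree S T Y × (∣ Y ∣ ≡ k)) ×
  ((Y : Subset n) → Agree S T Y → ∣ Y ∣ ≤ k)

-- For trees P and Q with c common leaves and heights summing to H we build an agreement set of
-- size z with c ^ 9 ≤ z ^ 41 · 2 ^ H, by recursion on P = (p₁, p₂) and Q = (q₁, q₂). Let cᵢⱼ be
-- the number of common leaves of pᵢ and qⱼ. If both blocks of the diagonal (or of the
-- anti-diagonal) satisfy cᵢⱼ ≥ c/27, the agreement sets of these two disjoint subproblems unite
-- to one for (P, Q); H drops by 2 and 27 ^ 9 ≤ 2 ^ 43 pays for halving the smaller of the two
-- sets. Otherwise two blocks of one row or column are below c/27, so the opposite row or column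
-- holds at least 25c/27 common leaves and we recurse into it; H drops by 1 and
-- 27 ^ 9 ≤ 2 · 25 ^ 9. For balanced trees with n leaves 2 ^ H = n ^ 2, so n ^ 7 ≤ z ^ 41,
-- and 7/41 > 0.17 > 1/6.

module Submission where

open import Defs
open import Data.Nat using (ℕ; _≤_; _<_; _^_)
open import Data.Fin using (Fin)
open import Data.Product using (_×_)

open import Data.Nat using (zero; suc; _+_; _*_; z≤n; s≤s; _≤?_; NonZero; >-nonZero)
open import Data.Nat.Properties
open import Data.Bool using (_∨_)
open import Data.Bool.Properties using (∨-identityʳ)
open import Data.Maybe using (Maybe; just; nothing)
open import Data.Vec using ([]; _∷_; lookup; here; there)
open import Data.Vec.Properties using (lookup-zipWith; []=⇒lookup; lookup⇒[]=)
open import Data.Fin.Subset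
  using (Subset; inside; outside; ∣_∣; _∈_; _∉_; _⊆_; _∪_; _∩_; ⁅_⁆; ⊤; ⊥)
open import Data.Fin.Subset.Properties
  using (x∈⁅x⁆; x∈⁅y⁆⇒x≡y; x∈p∪q⁻; x∈p∪q⁺; x∈p∩q⁺; x∈p∩q⁻; p⊆p∪q; q⊆p∪q; p∩q⊆p; ⊆-trans; ⊥⊆;
         ∉⊥; ∩-comm; ∪-comm; ∩-distribʳ-∪; p⊆q⇒∣p∣≤∣q∣; ∣⊤∣≡n; _∈?_)
open import Data.List using (List; []; _∷_; _++_; length; allFin)
open import Data.List.Properties using (length-tabulate)
open import Data.List.Membership.Propositional using () renaming (_∈_ to _∈ₗ_; _∉_ to _∉ₗ_)
open import Data.List.Membership.Propositional.Properties using (∈-allFin; ∈-++⁺ˡ; ∈-++⁺ʳ; ∈-++⁻)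
import Data.List.Relation.Unary.Any as Any
import Data.List.Relation.Unary.All as All
open import Data.List.Relation.Unary.All.Properties using (++⁻ˡ)
open import Data.List.Relation.Unary.Unique.Propositional using (Unique; []; _∷_)
open import Data.List.Relation.Unary.Unique.Propositional.Properties using (allFin⁺)
open import Data.List.Relation.Binary.Permutation.Propositional using (↭-sym; ↭⇒↭ₛ)
open import Data.List.Relation.Binary.Permutation.Propositional.Properties using (∈-resp-↭; ↭-length)
import Data.List.Relation.Binary.Permutation.Setoid.Properties as Perm
open import Data.Product using (Σ-syntax; _,_)
open import Data.Sum using (inj₁; inj₂)
import Data.Sum as Sum
open import Function using (id)
open import Relation.Nullary using (yes; no; contradiction)
open import Relation.Nullary.Decidable using (toWitness)
open import Relation.Binary.PropositionalEquality
open import Algebra.Properties.CommutativeSemigroup *-commutativeSemigroup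
  using (x∙yz≈y∙xz; xy∙z≈y∙xz)

private
  variable
    n : ℕ
    X : Set

-- Arithmetic

^-distribʳ-* : ∀ m n o → (m * n) ^ o ≡ m ^ o * n ^ o
^-distribʳ-* m n zero    = refl
^-distribʳ-* m n (suc o) = begin
  m * n * (m * n) ^ o     ≡⟨ cong (m * n *_) (^-distribʳ-* m n o) ⟩
  m * n * (m ^ o * n ^ o) ≡⟨ [m*n]*[o*p]≡[m*o]*[n*p] m n (m ^ o) (n ^ o) ⟩
  m * m ^ o * (n * n ^ o) ∎
  where open ≡-Reasoning

^-cancelˡ-≤ : ∀ o .{{_ : NonZero o}} {m n} → m ^ o ≤ n ^ o → m ≤ n
^-cancelˡ-≤ o mᵒ≤nᵒ = ≮⇒≥ (λ n<m → <⇒≱ (^-monoˡ-< o n<m) mᵒ≤nᵒ)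

m≤n⇒2*m≤m+n : ∀ {m n} → m ≤ n → 2 * m ≤ m + n
m≤n⇒2*m≤m+n {m} m≤n = ≤-trans (≤-reflexive (cong (m +_) (+-identityʳ m))) (+-monoʳ-≤ m m≤n)

m<n⇒o<p⇒2+[m+o]≤n+p : ∀ {m n o p} → m < n → o < p → 2 + (m + o) ≤ n + p
m<n⇒o<p⇒2+[m+o]≤n+p {m} {o = o} m<n o<p =
  ≤-trans (≤-reflexive (cong suc (sym (+-suc m o)))) (+-mono-≤ m<n o<p)

pigeonhole : ∀ a b r {c} → 27 * a < c → 27 * b < c → c ≡ a + b + r → 25 * c ≤ 27 * r
pigeonhole a b r {c} 27a<c 27b<c c≡a+b+r = +-cancelʳ-≤ (c + c) (25 * c) (27 * r) (begin
  25 * c + (c + c)         ≡⟨ cong (25 * c +_) (cong (c +_) (sym (+-identityʳ c))) ⟩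
  25 * c + 2 * c           ≡⟨ *-distribʳ-+ c 25 2 ⟨
  27 * c                   ≡⟨ cong (27 *_) c≡a+b+r ⟩
  27 * (a + b + r)         ≡⟨ *-distribˡ-+ 27 (a + b) r ⟩
  27 * (a + b) + 27 * r    ≡⟨ cong (_+ 27 * r) (*-distribˡ-+ 27 a b) ⟩
  27 * a + 27 * b + 27 * r ≤⟨ +-monoˡ-≤ (27 * r) (+-mono-≤ (<⇒≤ 27a<c) (<⇒≤ 27b<c)) ⟩
  c + c + 27 * r           ≡⟨ +-comm (c + c) (27 * r) ⟩
  27 * r + (c + c)         ∎)
  where open ≤-Reasoning

n^9≤z^41*n^2⇒n^7≤z^41 : ∀ n z → 1 ≤ n → n ^ 9 ≤ z ^ 41 * n ^ 2 → n ^ 7 ≤ z ^ 41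
n^9≤z^41*n^2⇒n^7≤z^41 n z 1≤n h = *-cancelʳ-≤ (n ^ 7) (z ^ 41) (n ^ 2) {{m^n≢0 n 2 {{>-nonZero 1≤n}}}}
  (subst (_≤ z ^ 41 * n ^ 2) (^-distribˡ-+-* n 7 2) h)

n^7≤k^41⇒n^17≤k^100 : ∀ n k → 1 ≤ n → n ^ 7 ≤ k ^ 41 → n ^ 17 ≤ k ^ 100
n^7≤k^41⇒n^17≤k^100 n k 1≤n h = ^-cancelˡ-≤ 41 (begin
  (n ^ 17) ^ 41  ≡⟨ ^-*-assoc n 17 41 ⟩
  n ^ 697        ≤⟨ ^-monoʳ-≤ n {{>-nonZero 1≤n}} (m≤m+n 697 3) ⟩
  n ^ 700        ≡⟨ ^-*-assoc n 7 100 ⟨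
  (n ^ 7) ^ 100  ≤⟨ ^-monoˡ-≤ 100 h ⟩
  (k ^ 41) ^ 100 ≡⟨ ^-*-assoc k 41 100 ⟩
  k ^ 4100       ≡⟨ ^-*-assoc k 100 41 ⟨
  (k ^ 100) ^ 41 ∎)
  where open ≤-Reasoning

n^7≤k^41⇒n<k^6 : ∀ n k → 2 ≤ n → n ^ 7 ≤ k ^ 41 → n < k ^ 6
n^7≤k^41⇒n<k^6 n k 2≤n h = ≰⇒> λ k^6≤n → <⇒≱ (^-monoʳ-< n 2≤n (n<1+n 41)) (begin
  n ^ 42       ≡⟨ ^-*-assoc n 7 6 ⟨
  (n ^ 7) ^ 6  ≤⟨ ^-monoˡ-≤ 6 h ⟩
  (k ^ 41) ^ 6 ≡⟨ ^-*-assoc k 41 6 ⟩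
  k ^ 246      ≡⟨ ^-*-assoc k 6 41 ⟨
  (k ^ 6) ^ 41 ≤⟨ ^-monoˡ-≤ 41 k^6≤n ⟩
  n ^ 41       ∎)
  where open ≤-Reasoning

Large : ℕ → ℕ → ℕ → Set
Large c z H = c ^ 9 ≤ z ^ 41 * 2 ^ H

Large-≤ : ∀ {c z} H → c ≤ z → Large c z H
Large-≤ {zero}      H _   = z≤n
Large-≤ {suc c} {z} H c≤z = begin
  suc c ^ 9      ≤⟨ ^-monoˡ-≤ 9 c≤z ⟩
  z ^ 9          ≤⟨ ^-monoʳ-≤ z (m≤m+n 9 32) ⟩
  z ^ 41         ≤⟨ m≤m*n (z ^ 41) (2 ^ H) {{m^n≢0 2 H}} ⟩
  z ^ 41 * 2 ^ H ∎
  where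
  open ≤-Reasoning
  instance
    z≢0 : NonZero z
    z≢0 = >-nonZero (≤-trans (s≤s z≤n) c≤z)

Large-single : ∀ c c′ z {H′ H} → 25 * c ≤ 27 * c′ → Large c′ z H′ → H′ < H → Large c z H
Large-single c c′ z {H′} {H} 25c≤27c′ large H′<H = begin
  c ^ 9                 ≤⟨ *-cancelˡ-≤ (25 ^ 9) scaled ⟩
  2 * c′ ^ 9            ≤⟨ *-monoʳ-≤ 2 large ⟩
  2 * (z ^ 41 * 2 ^ H′) ≡⟨ x∙yz≈y∙xz 2 (z ^ 41) (2 ^ H′) ⟩
  z ^ 41 * 2 ^ suc H′   ≤⟨ *-monoʳ-≤ (z ^ 41) (^-monoʳ-≤ 2 H′<H) ⟩
  z ^ 41 * 2 ^ H        ∎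
  where
  open ≤-Reasoning
  scaled : 25 ^ 9 * c ^ 9 ≤ 25 ^ 9 * (2 * c′ ^ 9)
  scaled = begin
    25 ^ 9 * c ^ 9        ≡⟨ ^-distribʳ-* 25 c 9 ⟨
    (25 * c) ^ 9          ≤⟨ ^-monoˡ-≤ 9 25c≤27c′ ⟩
    (27 * c′) ^ 9         ≡⟨ ^-distribʳ-* 27 c′ 9 ⟩
    27 ^ 9 * c′ ^ 9       ≤⟨ *-monoˡ-≤ (c′ ^ 9) (toWitness {a? = 27 ^ 9 ≤? 2 * 25 ^ 9} _) ⟩
    2 * 25 ^ 9 * c′ ^ 9   ≡⟨ xy∙z≈y∙xz 2 (25 ^ 9) (c′ ^ 9) ⟩
    25 ^ 9 * (2 * c′ ^ 9) ∎

Large-double-via : ∀ c c′ z′ z {H′ H} → c ≤ 27 * c′ → Large c′ z′ H′ → 2 + H′ ≤ H → 2 * z′ ≤ z →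
                   Large c z H
Large-double-via c c′ z′ z {H′} {H} c≤27c′ large 2+H′≤H 2z′≤z = begin
  c ^ 9                               ≤⟨ ^-monoˡ-≤ 9 c≤27c′ ⟩
  (27 * c′) ^ 9                       ≡⟨ ^-distribʳ-* 27 c′ 9 ⟩
  27 ^ 9 * c′ ^ 9                     ≤⟨ *-mono-≤ (toWitness {a? = 27 ^ 9 ≤? 2 ^ 41 * 2 ^ 2} _) large ⟩
  2 ^ 41 * 2 ^ 2 * (z′ ^ 41 * 2 ^ H′) ≡⟨ [m*n]*[o*p]≡[m*o]*[n*p] (2 ^ 41) (2 ^ 2) (z′ ^ 41) (2 ^ H′) ⟩
  2 ^ 41 * z′ ^ 41 * (2 ^ 2 * 2 ^ H′) ≡⟨ cong₂ _*_ (^-distribʳ-* 2 z′ 41) (^-distribˡ-+-* 2 2 H′) ⟨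
  (2 * z′) ^ 41 * 2 ^ (2 + H′)        ≤⟨ *-mono-≤ (^-monoˡ-≤ 41 2z′≤z) (^-monoʳ-≤ 2 2+H′≤H) ⟩
  z ^ 41 * 2 ^ H                      ∎
  where open ≤-Reasoning

Large-double : ∀ c c₁ c₂ z₁ z₂ z {H₁ H₂ H} → c ≤ 27 * c₁ → c ≤ 27 * c₂ →
               Large c₁ z₁ H₁ → Large c₂ z₂ H₂ → 2 + H₁ ≤ H → 2 + H₂ ≤ H → z₁ + z₂ ≤ z →
               Large c z H
Large-double c c₁ c₂ z₁ z₂ z c≤27c₁ c≤27c₂ large₁ large₂ 2+H₁≤H 2+H₂≤H z₁+z₂≤z with ≤-total z₁ z₂
... | inj₁ z₁≤z₂ = Large-double-via c c₁ z₁ z c≤27c₁ large₁ 2+H₁≤H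
  (≤-trans (m≤n⇒2*m≤m+n z₁≤z₂) z₁+z₂≤z)
... | inj₂ z₂≤z₁ = Large-double-via c c₂ z₂ z c≤27c₂ large₂ 2+H₂≤H
  (≤-trans (m≤n⇒2*m≤m+n z₂≤z₁) (≤-trans (≤-reflexive (+-comm z₂ z₁)) z₁+z₂≤z))

Disjoint : Subset n → Subset n → Set
Disjoint p q = ∀ {x} → x ∈ p → x ∉ q

Disjoint-sym : ∀ {p q : Subset n} → Disjoint p q → Disjoint q p
Disjoint-sym p#q x∈q x∈p = p#q x∈p x∈q

Disjoint-mono : ∀ {p p′ q q′ : Subset n} → p′ ⊆ p → q′ ⊆ q → Disjoint p q → Disjoint p′ q′
Disjoint-mono p′⊆p q′⊆q p#q x∈p′ x∈q′ = p#q (p′⊆p x∈p′) (q′⊆q x∈q′)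

Disjoint-tail : ∀ {a b} {p q : Subset n} → Disjoint (a ∷ p) (b ∷ q) → Disjoint p q
Disjoint-tail p#q x∈p x∈q = p#q (there x∈p) (there x∈q)

∣p∪q∣≡∣p∣+∣q∣ : ∀ {p q : Subset n} → Disjoint p q → ∣ p ∪ q ∣ ≡ ∣ p ∣ + ∣ q ∣
∣p∪q∣≡∣p∣+∣q∣ {p = []}          {[]}          _   = refl
∣p∪q∣≡∣p∣+∣q∣ {p = inside  ∷ p} {inside  ∷ q} p#q = contradiction here (p#q here)
∣p∪q∣≡∣p∣+∣q∣ {p = inside  ∷ p} {outside ∷ q} p#q = cong suc (∣p∪q∣≡∣p∣+∣q∣ (Disjoint-tail p#q))
∣p∪q∣≡∣p∣+∣q∣ {p = outside ∷ p} {inside  ∷ q} p#q =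
  trans (cong suc (∣p∪q∣≡∣p∣+∣q∣ (Disjoint-tail p#q))) (sym (+-suc ∣ p ∣ ∣ q ∣))
∣p∪q∣≡∣p∣+∣q∣ {p = outside ∷ p} {outside ∷ q} p#q = ∣p∪q∣≡∣p∣+∣q∣ (Disjoint-tail p#q)

∪-mono-⊆ : ∀ {p p′ q q′ : Subset n} → p ⊆ p′ → q ⊆ q′ → p ∪ q ⊆ p′ ∪ q′
∪-mono-⊆ {p = p} {q = q} p⊆p′ q⊆q′ x∈p∪q = x∈p∪q⁺ (Sum.map p⊆p′ q⊆q′ (x∈p∪q⁻ p q x∈p∪q))

x∈p⇒⁅x⁆⊆p : ∀ {p : Subset n} {x} → x ∈ p → ⁅ x ⁆ ⊆ p
x∈p⇒⁅x⁆⊆p {p = p} x∈p y∈⁅x⁆ = subst (_∈ p) (sym (x∈⁅y⁆⇒x≡y _ y∈⁅x⁆)) x∈p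

∉⇒lookup≡outside : ∀ {p : Subset n} {x} → x ∉ p → lookup p x ≡ outside
∉⇒lookup≡outside {p = p} {x} x∉p with lookup p x in eq
... | outside = refl
... | inside  = contradiction (lookup⇒[]= x p eq) x∉p

Disjoint⁅x⁆⇒lookup≡outside : ∀ {p : Subset n} {x} → Disjoint p ⁅ x ⁆ → lookup p x ≡ outside
Disjoint⁅x⁆⇒lookup≡outside p#x = ∉⇒lookup≡outside (λ x∈p → p#x x∈p (x∈⁅x⁆ _))

leafSet : BTree (Fin n) → Subset n
leafSet (leaf a)   = ⁅ a ⁆
leafSet (node l r) = leafSet l ∪ leafSet r

data Distinct {n} : BTree (Fin n) → Set where
  leaf : ∀ a → Distinct (leaf a)
  node : ∀ {l r} → Distinct l → Distinct r → Disjoint (leafSet l) (leafSet r) → Distinct (node l r)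

Distinct-disjoint : ∀ {l r : BTree (Fin n)} → Distinct (node l r) → Disjoint (leafSet l) (leafSet r)
Distinct-disjoint (node _ _ l#r) = l#r

common : BTree (Fin n) → BTree (Fin n) → ℕ
common P Q = ∣ leafSet P ∩ leafSet Q ∣

common-comm : ∀ (P Q : BTree (Fin n)) → common P Q ≡ common Q P
common-comm P Q = cong ∣_∣ (∩-comm (leafSet P) (leafSet Q))

common-nodeˡ : ∀ (l r Q : BTree (Fin n)) → Disjoint (leafSet l) (leafSet r) →
               common (node l r) Q ≡ common l Q + common r Q
common-nodeˡ l r Q l#r = trans (cong ∣_∣ (∩-distribʳ-∪ (leafSet Q) (leafSet l) (leafSet r)))
  (∣p∪q∣≡∣p∣+∣q∣ (Disjoint-mono (p∩q⊆p _ _) (p∩q⊆p _ _) l#r))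

common-nodeʳ : ∀ (P l r : BTree (Fin n)) → Disjoint (leafSet l) (leafSet r) →
               common P (node l r) ≡ common P l + common P r
common-nodeʳ P l r l#r = begin
  common P (node l r)     ≡⟨ common-comm P (node l r) ⟩
  common (node l r) P     ≡⟨ common-nodeˡ l r P l#r ⟩
  common l P + common r P ≡⟨ cong₂ _+_ (common-comm l P) (common-comm r P) ⟩
  common P l + common P r ∎
  where open ≡-Reasoning

height-nodeˡ : ∀ (l r : BTree X) → height l < height (node l r)
height-nodeˡ l r = s≤s (m≤m⊔n (height l) (height r))

height-nodeʳ : ∀ (l r : BTree X) → height r < height (node l r)
height-nodeʳ l r = s≤s (m≤n⊔m (height l) (height r))

-- Restriction

graft : Maybe (BTree X) → Maybe (BTree X) → Maybe (BTree X)
graft (just l) (just r) = just (node l r)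
graft (just l) nothing  = just l
graft nothing  m        = m

graft-identityʳ : ∀ (m : Maybe (BTree X)) → graft m nothing ≡ m
graft-identityʳ (just _) = refl
graft-identityʳ nothing  = refl

restrict-node : ∀ (Y : Subset n) l r → restrict Y (node l r) ≡ graft (restrict Y l) (restrict Y r)
restrict-node Y l r with restrict Y l | restrict Y r
... | just _  | just _  = refl
... | just _  | nothing = refl
... | nothing | just _  = refl
... | nothing | nothing = refl

restrict-∅ : ∀ {Y : Subset n} T → Disjoint Y (leafSet T) → restrict Y T ≡ nothing
restrict-∅ (leaf a) Y#a rewrite Disjoint⁅x⁆⇒lookup≡outside Y#a = refl
restrict-∅ {Y = Y} (node l r) Y#lr
  rewrite restrict-node Y l r
        | restrict-∅ l (Disjoint-mono id (p⊆p∪q _) Y#lr)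
        | restrict-∅ r (Disjoint-mono id (q⊆p∪q _ _) Y#lr) = refl

restrict-⊆ˡ : ∀ {Y : Subset n} l r → Disjoint (leafSet l) (leafSet r) → Y ⊆ leafSet l →
              restrict Y (node l r) ≡ restrict Y l
restrict-⊆ˡ {Y = Y} l r l#r Y⊆l = begin
  restrict Y (node l r)             ≡⟨ restrict-node Y l r ⟩
  graft (restrict Y l) (restrict Y r) ≡⟨ cong (graft _) (restrict-∅ r (Disjoint-mono Y⊆l id l#r)) ⟩
  graft (restrict Y l) nothing      ≡⟨ graft-identityʳ _ ⟩
  restrict Y l                      ∎
  where open ≡-Reasoning

restrict-⊆ʳ : ∀ {Y : Subset n} l r → Disjoint (leafSet l) (leafSet r) → Y ⊆ leafSet r →
              restrict Y (node l r) ≡ restrict Y r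
restrict-⊆ʳ {Y = Y} l r l#r Y⊆r = trans (restrict-node Y l r)
  (cong (λ m → graft m (restrict Y r)) (restrict-∅ l (Disjoint-mono Y⊆r id (Disjoint-sym l#r))))

restrict-∪ˡ : ∀ {Y₁ Y₂ : Subset n} T → Disjoint Y₂ (leafSet T) → restrict (Y₁ ∪ Y₂) T ≡ restrict Y₁ T
restrict-∪ˡ {Y₁ = Y₁} {Y₂} (leaf a) Y₂#a
  rewrite lookup-zipWith _∨_ a Y₁ Y₂ | Disjoint⁅x⁆⇒lookup≡outside Y₂#a | ∨-identityʳ (lookup Y₁ a) = refl
restrict-∪ˡ {Y₁ = Y₁} {Y₂} (node l r) Y₂#lr
  rewrite restrict-node (Y₁ ∪ Y₂) l r | restrict-node Y₁ l r
        | restrict-∪ˡ {Y₁ = Y₁} l (Disjoint-mono id (p⊆p∪q _) Y₂#lr)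
        | restrict-∪ˡ {Y₁ = Y₁} r (Disjoint-mono id (q⊆p∪q _ _) Y₂#lr) = refl

restrict-∪ʳ : ∀ {Y₁ Y₂ : Subset n} T → Disjoint Y₁ (leafSet T) → restrict (Y₁ ∪ Y₂) T ≡ restrict Y₂ T
restrict-∪ʳ {Y₁ = Y₁} {Y₂} T Y₁#T =
  trans (cong (λ Y → restrict Y T) (∪-comm Y₁ Y₂)) (restrict-∪ˡ T Y₁#T)

restrict-∪-node : ∀ {Y₁ Y₂ : Subset n} l r → Disjoint (leafSet l) (leafSet r) →
                  Y₁ ⊆ leafSet l → Y₂ ⊆ leafSet r →
                  restrict (Y₁ ∪ Y₂) (node l r) ≡ graft (restrict Y₁ l) (restrict Y₂ r)
restrict-∪-node {Y₁ = Y₁} {Y₂} l r l#r Y₁⊆l Y₂⊆r = trans (restrict-node (Y₁ ∪ Y₂) l r)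
  (cong₂ graft (restrict-∪ˡ l (Disjoint-mono Y₂⊆r id (Disjoint-sym l#r)))
               (restrict-∪ʳ r (Disjoint-mono Y₁⊆l id l#r)))

restrict-⁅⁆ : ∀ {a} {T : BTree (Fin n)} → Distinct T → a ∈ leafSet T → restrict ⁅ a ⁆ T ≡ just (leaf a)
restrict-⁅⁆ {a = a} (leaf b) a∈b with x∈⁅y⁆⇒x≡y b a∈b
... | refl rewrite []=⇒lookup (x∈⁅x⁆ a) = refl
restrict-⁅⁆ {a = a} (node {l} {r} dl dr l#r) a∈lr with x∈p∪q⁻ (leafSet l) (leafSet r) a∈lr
... | inj₁ a∈l = trans (restrict-⊆ˡ l r l#r (x∈p⇒⁅x⁆⊆p a∈l)) (restrict-⁅⁆ dl a∈l)
... | inj₂ a∈r = trans (restrict-⊆ʳ l r l#r (x∈p⇒⁅x⁆⊆p a∈r)) (restrict-⁅⁆ dr a∈r)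

≅-sym : ∀ {S T : BTree X} → S ≅ T → T ≅ S
≅-sym (leaf≅ a)   = leaf≅ a
≅-sym (node≅ p q) = node≅ (≅-sym p) (≅-sym q)
≅-sym (swap≅ p q) = swap≅ (≅-sym q) (≅-sym p)

≅ᴹ-sym : ∀ {M N : Maybe (BTree X)} → M ≅ᴹ N → N ≅ᴹ M
≅ᴹ-sym nothing≅  = nothing≅
≅ᴹ-sym (just≅ p) = just≅ (≅-sym p)

graft-cong : ∀ {M₁ M₂ N₁ N₂ : Maybe (BTree X)} → M₁ ≅ᴹ N₁ → M₂ ≅ᴹ N₂ → graft M₁ M₂ ≅ᴹ graft N₁ N₂
graft-cong (just≅ p) (just≅ q) = just≅ (node≅ p q)
graft-cong (just≅ p) nothing≅  = just≅ p
graft-cong nothing≅  q         = q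

graft-cong-swap : ∀ {M₁ M₂ N₁ N₂ : Maybe (BTree X)} → M₁ ≅ᴹ N₁ → M₂ ≅ᴹ N₂ →
                  graft M₁ M₂ ≅ᴹ graft N₂ N₁
graft-cong-swap (just≅ p) (just≅ q) = just≅ (swap≅ p q)
graft-cong-swap (just≅ p) nothing≅  = just≅ p
graft-cong-swap nothing≅  (just≅ q) = just≅ q
graft-cong-swap nothing≅  nothing≅  = nothing≅

record Agreement {n} (P Q : BTree (Fin n)) : Set where
  field
    set   : Subset n
    set⊆P : set ⊆ leafSet P
    set⊆Q : set ⊆ leafSet Q
    agree : Agree P Q set

open Agreement

Agreement-sym : ∀ {P Q : BTree (Fin n)} → Agreement P Q → Agreement Q P
Agreement-sym A = record { set = set A ; set⊆P = set⊆Q A ; set⊆Q = set⊆P A ; agree = ≅ᴹ-sym (agree A) }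

Agreement-nodeˡ : ∀ {l r Q : BTree (Fin n)} → Disjoint (leafSet l) (leafSet r) →
                  Agreement l Q → Agreement (node l r) Q
Agreement-nodeˡ {l = l} {r} {Q} l#r A = record
  { set   = set A
  ; set⊆P = ⊆-trans (set⊆P A) (p⊆p∪q _)
  ; set⊆Q = set⊆Q A
  ; agree = subst (_≅ᴹ restrict (set A) Q) (sym (restrict-⊆ˡ l r l#r (set⊆P A))) (agree A)
  }

Agreement-nodeʳ : ∀ {l r Q : BTree (Fin n)} → Disjoint (leafSet l) (leafSet r) →
                  Agreement r Q → Agreement (node l r) Q
Agreement-nodeʳ {l = l} {r} {Q} l#r A = record
  { set   = set A
  ; set⊆P = ⊆-trans (set⊆P A) (q⊆p∪q _ _)
  ; set⊆Q = set⊆Q A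
  ; agree = subst (_≅ᴹ restrict (set A) Q) (sym (restrict-⊆ʳ l r l#r (set⊆P A))) (agree A)
  }

Agreement-∪ : ∀ {p₁ p₂ q₁ q₂ : BTree (Fin n)} →
              Disjoint (leafSet p₁) (leafSet p₂) → Disjoint (leafSet q₁) (leafSet q₂) →
              Agreement p₁ q₁ → Agreement p₂ q₂ → Agreement (node p₁ p₂) (node q₁ q₂)
Agreement-∪ {p₁ = p₁} {p₂} {q₁} {q₂} p₁#p₂ q₁#q₂ A₁ A₂ = record
  { set   = set A₁ ∪ set A₂
  ; set⊆P = ∪-mono-⊆ (set⊆P A₁) (set⊆P A₂)
  ; set⊆Q = ∪-mono-⊆ (set⊆Q A₁) (set⊆Q A₂)
  ; agree = subst₂ _≅ᴹ_ (sym (restrict-∪-node p₁ p₂ p₁#p₂ (set⊆P A₁) (set⊆P A₂)))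
                        (sym (restrict-∪-node q₁ q₂ q₁#q₂ (set⊆Q A₁) (set⊆Q A₂)))
                        (graft-cong (agree A₁) (agree A₂))
  }

Agreement-∪-cross : ∀ {p₁ p₂ q₁ q₂ : BTree (Fin n)} →
                    Disjoint (leafSet p₁) (leafSet p₂) → Disjoint (leafSet q₁) (leafSet q₂) →
                    Agreement p₁ q₂ → Agreement p₂ q₁ → Agreement (node p₁ p₂) (node q₁ q₂)
Agreement-∪-cross {p₁ = p₁} {p₂} {q₁} {q₂} p₁#p₂ q₁#q₂ A₁ A₂ = record
  { set   = set A₁ ∪ set A₂
  ; set⊆P = ∪-mono-⊆ (set⊆P A₁) (set⊆P A₂)
  ; set⊆Q = subst (_⊆ leafSet (node q₁ q₂)) (∪-comm (set A₂) (set A₁)) (∪-mono-⊆ (set⊆Q A₂) (set⊆Q A₁))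
  ; agree = subst₂ _≅ᴹ_ (sym (restrict-∪-node p₁ p₂ p₁#p₂ (set⊆P A₁) (set⊆P A₂)))
                        (sym (trans (cong (λ Y → restrict Y (node q₁ q₂)) (∪-comm (set A₁) (set A₂)))
                                    (restrict-∪-node q₁ q₂ q₁#q₂ (set⊆Q A₂) (set⊆Q A₁))))
                        (graft-cong-swap (agree A₁) (agree A₂))
  }

leaf-agreement : ∀ a {Q : BTree (Fin n)} → Distinct Q →
                 Σ[ A ∈ Agreement (leaf a) Q ] leafSet (leaf a) ∩ leafSet Q ⊆ set A
leaf-agreement a {Q} dQ with a ∈? leafSet Q
... | yes a∈Q = A , p∩q⊆p _ _
  where
  A : Agreement (leaf a) Q
  A = record
    { set   = ⁅ a ⁆
    ; set⊆P = id
    ; set⊆Q = x∈p⇒⁅x⁆⊆p a∈Q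
    ; agree = subst₂ _≅ᴹ_ (sym (restrict-⁅⁆ (leaf a) (x∈⁅x⁆ a))) (sym (restrict-⁅⁆ dQ a∈Q))
                          (just≅ (leaf≅ a))
    }
... | no a∉Q = A , λ x∈a∩Q → contradiction (common⇒a∈Q (x∈p∩q⁻ _ _ x∈a∩Q)) a∉Q
  where
  common⇒a∈Q : ∀ {x} → x ∈ ⁅ a ⁆ × x ∈ leafSet Q → a ∈ leafSet Q
  common⇒a∈Q (x∈a , x∈Q) = subst (_∈ leafSet Q) (x∈⁅y⁆⇒x≡y a x∈a) x∈Q
  ⊥#T : ∀ T → Disjoint ⊥ (leafSet T)
  ⊥#T T x∈⊥ _ = ∉⊥ x∈⊥
  A : Agreement (leaf a) Q
  A = record
    { set   = ⊥
    ; set⊆P = ⊥⊆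
    ; set⊆Q = ⊥⊆
    ; agree = subst₂ _≅ᴹ_ (sym (restrict-∅ (leaf a) (⊥#T (leaf a)))) (sym (restrict-∅ Q (⊥#T Q)))
                          nothing≅
    }

-- Large agreement sets

LargeAgreement : BTree (Fin n) → BTree (Fin n) → Set
LargeAgreement P Q = Σ[ A ∈ Agreement P Q ] Large (common P Q) ∣ set A ∣ (height P + height Q)

large-sym : ∀ {P Q : BTree (Fin n)} → LargeAgreement P Q → LargeAgreement Q P
large-sym {P = P} {Q} (A , large) = Agreement-sym A ,
  subst₂ (λ c H → Large c ∣ set A ∣ H) (common-comm P Q) (+-comm (height P) (height Q)) large

large-leaf : ∀ a {Q : BTree (Fin n)} → Distinct Q → LargeAgreement (leaf a) Q
large-leaf a {Q} dQ with leaf-agreement a dQ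
... | A , common⊆A = A , Large-≤ (height (leaf a) + height Q) (p⊆q⇒∣p∣≤∣q∣ common⊆A)

large-row₁ : ∀ {l r Q : BTree (Fin n)} → Disjoint (leafSet l) (leafSet r) → LargeAgreement l Q →
             25 * common (node l r) Q ≤ 27 * common l Q → LargeAgreement (node l r) Q
large-row₁ {l = l} {r} {Q} l#r (A , large) h = Agreement-nodeˡ l#r A ,
  Large-single (common (node l r) Q) (common l Q) ∣ set A ∣ h large
    (+-monoˡ-< (height Q) (height-nodeˡ l r))

large-row₂ : ∀ {l r Q : BTree (Fin n)} → Disjoint (leafSet l) (leafSet r) → LargeAgreement r Q →
             25 * common (node l r) Q ≤ 27 * common r Q → LargeAgreement (node l r) Q
large-row₂ {l = l} {r} {Q} l#r (A , large) h = Agreement-nodeʳ l#r A ,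
  Large-single (common (node l r) Q) (common r Q) ∣ set A ∣ h large
    (+-monoˡ-< (height Q) (height-nodeʳ l r))

large-col₁ : ∀ {P l r : BTree (Fin n)} → Disjoint (leafSet l) (leafSet r) → LargeAgreement P l →
             25 * common P (node l r) ≤ 27 * common P l → LargeAgreement P (node l r)
large-col₁ {P = P} {l} {r} l#r (A , large) h = Agreement-sym (Agreement-nodeˡ l#r (Agreement-sym A)) ,
  Large-single (common P (node l r)) (common P l) ∣ set A ∣ h large
    (+-monoʳ-< (height P) (height-nodeˡ l r))

large-col₂ : ∀ {P l r : BTree (Fin n)} → Disjoint (leafSet l) (leafSet r) → LargeAgreement P r →
             25 * common P (node l r) ≤ 27 * common P r → LargeAgreement P (node l r)
large-col₂ {P = P} {l} {r} l#r (A , large) h = Agreement-sym (Agreement-nodeʳ l#r (Agreement-sym A)) ,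
  Large-single (common P (node l r)) (common P r) ∣ set A ∣ h large
    (+-monoʳ-< (height P) (height-nodeʳ l r))

large-diagonal : ∀ {p₁ p₂ q₁ q₂ : BTree (Fin n)} →
                 Disjoint (leafSet p₁) (leafSet p₂) → Disjoint (leafSet q₁) (leafSet q₂) →
                 LargeAgreement p₁ q₁ → LargeAgreement p₂ q₂ →
                 common (node p₁ p₂) (node q₁ q₂) ≤ 27 * common p₁ q₁ →
                 common (node p₁ p₂) (node q₁ q₂) ≤ 27 * common p₂ q₂ →
                 LargeAgreement (node p₁ p₂) (node q₁ q₂)
large-diagonal {p₁ = p₁} {p₂} {q₁} {q₂} p₁#p₂ q₁#q₂ (A₁ , large₁) (A₂ , large₂) h₁ h₂ =
  Agreement-∪ p₁#p₂ q₁#q₂ A₁ A₂ ,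
  Large-double (common (node p₁ p₂) (node q₁ q₂)) (common p₁ q₁) (common p₂ q₂)
    (∣ set A₁ ∣) (∣ set A₂ ∣) (∣ set A₁ ∪ set A₂ ∣) h₁ h₂ large₁ large₂
    (m<n⇒o<p⇒2+[m+o]≤n+p (height-nodeˡ p₁ p₂) (height-nodeˡ q₁ q₂))
    (m<n⇒o<p⇒2+[m+o]≤n+p (height-nodeʳ p₁ p₂) (height-nodeʳ q₁ q₂))
    (≤-reflexive (sym (∣p∪q∣≡∣p∣+∣q∣ (Disjoint-mono (set⊆P A₁) (set⊆P A₂) p₁#p₂))))

large-antidiagonal : ∀ {p₁ p₂ q₁ q₂ : BTree (Fin n)} →
                     Disjoint (leafSet p₁) (leafSet p₂) → Disjoint (leafSet q₁) (leafSet q₂) →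
                     LargeAgreement p₁ q₂ → LargeAgreement p₂ q₁ →
                     common (node p₁ p₂) (node q₁ q₂) ≤ 27 * common p₁ q₂ →
                     common (node p₁ p₂) (node q₁ q₂) ≤ 27 * common p₂ q₁ →
                     LargeAgreement (node p₁ p₂) (node q₁ q₂)
large-antidiagonal {p₁ = p₁} {p₂} {q₁} {q₂} p₁#p₂ q₁#q₂ (A₁ , large₁) (A₂ , large₂) h₁ h₂ =
  Agreement-∪-cross p₁#p₂ q₁#q₂ A₁ A₂ ,
  Large-double (common (node p₁ p₂) (node q₁ q₂)) (common p₁ q₂) (common p₂ q₁)
    (∣ set A₁ ∣) (∣ set A₂ ∣) (∣ set A₁ ∪ set A₂ ∣) h₁ h₂ large₁ large₂
    (m<n⇒o<p⇒2+[m+o]≤n+p (height-nodeˡ p₁ p₂) (height-nodeʳ q₁ q₂))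
    (m<n⇒o<p⇒2+[m+o]≤n+p (height-nodeʳ p₁ p₂) (height-nodeˡ q₁ q₂))
    (≤-reflexive (sym (∣p∪q∣≡∣p∣+∣q∣ (Disjoint-mono (set⊆P A₁) (set⊆P A₂) p₁#p₂))))

data Split {n} (p₁ p₂ q₁ q₂ : BTree (Fin n)) : Set where
  diagonal     : common (node p₁ p₂) (node q₁ q₂) ≤ 27 * common p₁ q₁ →
                 common (node p₁ p₂) (node q₁ q₂) ≤ 27 * common p₂ q₂ → Split p₁ p₂ q₁ q₂
  antidiagonal : common (node p₁ p₂) (node q₁ q₂) ≤ 27 * common p₁ q₂ →
                 common (node p₁ p₂) (node q₁ q₂) ≤ 27 * common p₂ q₁ → Split p₁ p₂ q₁ q₂
  row₁ : 25 * common (node p₁ p₂) (node q₁ q₂) ≤ 27 * common p₁ (node q₁ q₂) → Split p₁ p₂ q₁ q₂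
  row₂ : 25 * common (node p₁ p₂) (node q₁ q₂) ≤ 27 * common p₂ (node q₁ q₂) → Split p₁ p₂ q₁ q₂
  col₁ : 25 * common (node p₁ p₂) (node q₁ q₂) ≤ 27 * common (node p₁ p₂) q₁ → Split p₁ p₂ q₁ q₂
  col₂ : 25 * common (node p₁ p₂) (node q₁ q₂) ≤ 27 * common (node p₁ p₂) q₂ → Split p₁ p₂ q₁ q₂

module _ {p₁ p₂ q₁ q₂ : BTree (Fin n)} (dP : Distinct (node p₁ p₂)) (dQ : Distinct (node q₁ q₂)) where

  private
    P Q : BTree (Fin n)
    P = node p₁ p₂
    Q = node q₁ q₂

    by-rows : common P Q ≡ common p₁ Q + common p₂ Q
    by-rows = common-nodeˡ p₁ p₂ Q (Distinct-disjoint dP)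

    by-cols : common P Q ≡ common P q₁ + common P q₂
    by-cols = common-nodeʳ P q₁ q₂ (Distinct-disjoint dQ)

    row : ∀ p → common p Q ≡ common p q₁ + common p q₂
    row p = common-nodeʳ p q₁ q₂ (Distinct-disjoint dQ)

    col : ∀ q → common P q ≡ common p₁ q + common p₂ q
    col q = common-nodeˡ p₁ p₂ q (Distinct-disjoint dP)

  split : Split p₁ p₂ q₁ q₂
  split with common P Q ≤? 27 * common p₁ q₁ | common P Q ≤? 27 * common p₂ q₂
           | common P Q ≤? 27 * common p₁ q₂ | common P Q ≤? 27 * common p₂ q₁
  ... | yes h₁ | yes h₂ | _      | _      = diagonal h₁ h₂
  ... | _      | _      | yes h₁ | yes h₂ = antidiagonal h₁ h₂
  ... | no h₁₁ | _      | no h₁₂ | _      =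
    row₂ (pigeonhole (common p₁ q₁) (common p₁ q₂) (common p₂ Q) (≰⇒> h₁₁) (≰⇒> h₁₂)
      (trans by-rows (cong (_+ common p₂ Q) (row p₁))))
  ... | no h₁₁ | _      | _      | no h₂₁ =
    col₂ (pigeonhole (common p₁ q₁) (common p₂ q₁) (common P q₂) (≰⇒> h₁₁) (≰⇒> h₂₁)
      (trans by-cols (cong (_+ common P q₂) (col q₁))))
  ... | _      | no h₂₂ | no h₁₂ | _      =
    col₁ (pigeonhole (common p₁ q₂) (common p₂ q₂) (common P q₁) (≰⇒> h₁₂) (≰⇒> h₂₂)
      (trans by-cols (trans (+-comm (common P q₁) _) (cong (_+ common P q₁) (col q₂)))))
  ... | _      | no h₂₂ | _      | no h₂₁ =
    row₁ (pigeonhole (common p₂ q₁) (common p₂ q₂) (common p₁ Q) (≰⇒> h₂₁) (≰⇒> h₂₂)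
      (trans by-rows (trans (+-comm (common p₁ Q) _) (cong (_+ common p₁ Q) (row p₂)))))

large-node : ∀ {p₁ p₂ q₁ q₂ : BTree (Fin n)} → Distinct (node p₁ p₂) → Distinct (node q₁ q₂) →
             LargeAgreement p₁ q₁ → LargeAgreement p₂ q₂ → LargeAgreement p₁ q₂ → LargeAgreement p₂ q₁ →
             LargeAgreement p₁ (node q₁ q₂) → LargeAgreement p₂ (node q₁ q₂) →
             LargeAgreement (node p₁ p₂) q₁ → LargeAgreement (node p₁ p₂) q₂ →
             LargeAgreement (node p₁ p₂) (node q₁ q₂)
large-node dP dQ L₁₁ L₂₂ L₁₂ L₂₁ L₁∙ L₂∙ L∙₁ L∙₂ with split dP dQ
... | diagonal h₁ h₂     = large-diagonal (Distinct-disjoint dP) (Distinct-disjoint dQ) L₁₁ L₂₂ h₁ h₂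
... | antidiagonal h₁ h₂ = large-antidiagonal (Distinct-disjoint dP) (Distinct-disjoint dQ) L₁₂ L₂₁ h₁ h₂
... | row₁ h = large-row₁ (Distinct-disjoint dP) L₁∙ h
... | row₂ h = large-row₂ (Distinct-disjoint dP) L₂∙ h
... | col₁ h = large-col₁ (Distinct-disjoint dQ) L∙₁ h
... | col₂ h = large-col₂ (Distinct-disjoint dQ) L∙₂ h

-- Taking all eight recursive results as arguments of large-node (at most two are used) keeps every
-- recursive call visibly structural for the termination checker.
large-agreement : ∀ {P Q : BTree (Fin n)} → Distinct P → Distinct Q → LargeAgreement P Q
large-agreement (leaf a) dQ = large-leaf a dQ
large-agreement dP@(node _ _ _) (leaf b) = large-sym (large-leaf b dP)
large-agreement dP@(node d₁ d₂ _) dQ@(node e₁ e₂ _) = large-node dP dQ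
  (large-agreement d₁ e₁) (large-agreement d₂ e₂) (large-agreement d₁ e₂) (large-agreement d₂ e₁)
  (large-agreement d₁ dQ) (large-agreement d₂ dQ) (large-agreement dP e₁) (large-agreement dP e₂)

-- Phylogenetic trees

∈leafSet⇒∈leaves : ∀ {x} (T : BTree (Fin n)) → x ∈ leafSet T → x ∈ₗ leaves T
∈leafSet⇒∈leaves (leaf a) x∈a = Any.here (x∈⁅y⁆⇒x≡y a x∈a)
∈leafSet⇒∈leaves (node l r) x∈lr with x∈p∪q⁻ (leafSet l) (leafSet r) x∈lr
... | inj₁ x∈l = ∈-++⁺ˡ (∈leafSet⇒∈leaves l x∈l)
... | inj₂ x∈r = ∈-++⁺ʳ (leaves l) (∈leafSet⇒∈leaves r x∈r)

∈leaves⇒∈leafSet : ∀ {x} (T : BTree (Fin n)) → x ∈ₗ leaves T → x ∈ leafSet T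
∈leaves⇒∈leafSet (leaf a) (Any.here refl) = x∈⁅x⁆ a
∈leaves⇒∈leafSet (node l r) x∈lr with ∈-++⁻ (leaves l) x∈lr
... | inj₁ x∈l = x∈p∪q⁺ (inj₁ (∈leaves⇒∈leafSet l x∈l))
... | inj₂ x∈r = x∈p∪q⁺ (inj₂ (∈leaves⇒∈leafSet r x∈r))

Unique-++⁻ : ∀ {xs ys : List X} → Unique (xs ++ ys) →
             Unique xs × Unique ys × (∀ {x} → x ∈ₗ xs → x ∉ₗ ys)
Unique-++⁻ {xs = []}     u        = [] , u , λ ()
Unique-++⁻ {xs = x ∷ xs} (x∉ ∷ u) with Unique-++⁻ u
... | u-xs , u-ys , xs#ys = ++⁻ˡ xs x∉ ∷ u-xs , u-ys , x∷xs#ys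
  where
  x∷xs#ys : ∀ {y} → y ∈ₗ x ∷ xs → y ∉ₗ _
  x∷xs#ys (Any.here refl)  y∈ys = All.lookup x∉ (∈-++⁺ʳ xs y∈ys) refl
  x∷xs#ys (Any.there y∈xs) = xs#ys y∈xs

Unique⇒Distinct : ∀ (T : BTree (Fin n)) → Unique (leaves T) → Distinct T
Unique⇒Distinct (leaf a)   _ = leaf a
Unique⇒Distinct (node l r) u with Unique-++⁻ {xs = leaves l} u
... | u-l , u-r , l#r = node (Unique⇒Distinct l u-l) (Unique⇒Distinct r u-r)
  (λ x∈l x∈r → l#r (∈leafSet⇒∈leaves l x∈l) (∈leafSet⇒∈leaves r x∈r))

module _ (T : BTree (Fin n)) (phylo : IsPhyloTree n T) where

  phylo⇒Distinct : Distinct T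
  phylo⇒Distinct =
    Unique⇒Distinct T (Perm.Unique-resp-↭ (setoid (Fin n)) (↭⇒↭ₛ (↭-sym phylo)) (allFin⁺ n))

  phylo⇒∈leafSet : ∀ x → x ∈ leafSet T
  phylo⇒∈leafSet x = ∈leaves⇒∈leafSet T (∈-resp-↭ (↭-sym phylo) (∈-allFin x))

  balanced-phylo⇒2^height≡n : IsBalanced T → 2 ^ height T ≡ n
  balanced-phylo⇒2^height≡n (m , length≡2^m , height≡m) = begin
    2 ^ height T      ≡⟨ cong (2 ^_) height≡m ⟩
    2 ^ m             ≡⟨ length≡2^m ⟨
    length (leaves T) ≡⟨ ↭-length phylo ⟩
    length (allFin n) ≡⟨ length-tabulate id ⟩
    n                 ∎
    where open ≡-Reasoning

balanced-agreement : ∀ (S T : BTree (Fin n)) → 1 ≤ n → IsPhyloTree n S → IsPhyloTree n T →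
                     IsBalanced S → IsBalanced T → Σ[ Y ∈ Subset n ] Agree S T Y × n ^ 7 ≤ ∣ Y ∣ ^ 41
balanced-agreement {n} S T 1≤n phylo-S phylo-T balanced-S balanced-T
  with large-agreement (phylo⇒Distinct S phylo-S) (phylo⇒Distinct T phylo-T)
... | A , large = set A , agree A , n^9≤z^41*n^2⇒n^7≤z^41 n ∣ set A ∣ 1≤n (begin
  n ^ 9                                      ≤⟨ ^-monoˡ-≤ 9 n≤common ⟩
  common S T ^ 9                             ≤⟨ large ⟩
  ∣ set A ∣ ^ 41 * 2 ^ (height S + height T) ≡⟨ cong (∣ set A ∣ ^ 41 *_) 2^H≡n^2 ⟩
  ∣ set A ∣ ^ 41 * n ^ 2                     ∎)
  where
  open ≤-Reasoning
  n≤common : n ≤ common S T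
  n≤common = subst (_≤ common S T) (∣⊤∣≡n n) (p⊆q⇒∣p∣≤∣q∣ {p = ⊤}
    (λ {x} _ → x∈p∩q⁺ (phylo⇒∈leafSet S phylo-S x , phylo⇒∈leafSet T phylo-T x)))
  2^H≡n^2 : 2 ^ (height S + height T) ≡ n ^ 2
  2^H≡n^2 = trans (^-distribˡ-+-* 2 (height S) (height T))
    (cong₂ _*_ (balanced-phylo⇒2^height≡n S phylo-S balanced-S)
               (trans (balanced-phylo⇒2^height≡n T phylo-T balanced-T) (sym (*-identityʳ n))))

theorem3 : (n : ℕ) → 1 ≤ n → (S T : BTree (Fin n)) →
           IsPhyloTree n S → IsPhyloTree n T →
           IsBalanced S → IsBalanced T →
           (k : ℕ) → IsMast S T k →
           (n ^ 17 ≤ k ^ 100) × (2 ≤ n → n < k ^ 6)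
theorem3 n 1≤n S T phylo-S phylo-T balanced-S balanced-T k (_ , maximal) =
  n^7≤k^41⇒n^17≤k^100 n k 1≤n n^7≤k^41 , λ 2≤n → n^7≤k^41⇒n<k^6 n k 2≤n n^7≤k^41
  where
  n^7≤k^41 : n ^ 7 ≤ k ^ 41
  n^7≤k^41 with balanced-agreement S T 1≤n phylo-S phylo-T balanced-S balanced-T
  ... | Y , agree-Y , n^7≤∣Y∣^41 = ≤-trans n^7≤∣Y∣^41 (^-monoˡ-≤ 41 (maximal Y agree-Y))
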